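{- Let $G$ be a finite simple graph. (1) If $G'$ is obtained from $G$ by adding a pendant vertex $w$ to a vertex $u$ (a new vertex $w$ and edge $uw$), then $q_N(G';x)=q_N(G;x)+x\,q_N(G-u;x)$. (2) If $G''$ is obtained from $G$ by adding a false twin $w$ of a non-isolated vertex $v$ (a new vertex adjacent exactly to the neighbors of $v$, not to $v$), and $u$ is a vertex adjacent to $v$, then $q_N(G'';x)=q_N(G;x)+x\,q_N(G^{uv}-u;x)$. (3) If $G'''$ is obtained from $G$ by adding a true twin $w$ of a non-isolated vertex $v$ (a new vertex adjacent to $v$ and to exactly the neighbors of $v$), then $q_N(G''';x)=2q_N(G;x)$.
   Context: $q_N(K;x)=\sum_{W\subseteq V(K)}(x-1)^{n(K[W])}$, where $n(K[W])$ is the $\mathbb{F}_2$-nullity of the adjacency matrix of the induced subgraph $K[W]$ (the empty set contributing $1$); equivalently $q_N(E_n;x)=x^n$ for the edgeless graph on $n$ vertices and $q_N(K;x)=q_N(K-a;x)+q_N(K^{ab}-b;x)$ for any edge $ab$. Pivot: for an edge $uv$, let $A_u$, $A_v$, $A_{uv}$ be the sets of vertices other than $u,v$ adjacent to $u$ only, to $v$ only, and to both; $G^{uv}$ has the same vertices and edge set the symmetric difference of $E(G)$ with the edge set of the complete tripartite graph with classes $A_u,A_v,A_{uv}$. -}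

module Defs where

open import Data.Bool using (Bool; true; false; _xor_; _∧_; _∨_; not; if_then_else_)
open import Data.Nat using (ℕ; zero; suc; _∸_)
open import Data.Fin using (Fin; zero; suc; punchIn; _≟_)
open import Data.List using (List; []; _∷_; map; zipWith; length; filter; foldr)
open import Data.List as L using ()
open import Data.Vec using (Vec; []; _∷_; lookup)
open import Data.Maybe using (Maybe; just; nothing)
open import Data.Product using (_×_; _,_; ∃)
open import Data.Integer as ℤ using (ℤ)
open import Relation.Nullary using (does)
open import Relation.Binary.PropositionalEquality using (_≡_)

Graph : ℕ → Set
Graph n = Fin n → Fin n → Bool

record IsSimple {n : ℕ} (G : Graph n) : Set where
  field
    sym     : ∀ i j → G i j ≡ G j i
    irrefl  : ∀ i → G i i ≡ false

_==_ : ∀ {n} → Fin n → Fin n → Bool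
i == j = does (i ≟ j)

firstTrue : List Bool → Maybe ℕ
firstTrue [] = nothing
firstTrue (true ∷ _) = just zero
firstTrue (false ∷ bs) with firstTrue bs
... | just k = just (suc k)
... | nothing = nothing

at : List Bool → ℕ → Bool
at [] _ = false
at (b ∷ _) zero = b
at (_ ∷ bs) (suc k) = at bs k

elimRow : List Bool → ℕ → List Bool → List Bool
elimRow p c r = if at r c then zipWith _xor_ r p else r

rankFuel : ℕ → List (List Bool) → ℕ
rankFuel zero _ = zero
rankFuel (suc f) [] = zero
rankFuel (suc f) (r ∷ rs) with firstTrue r
... | nothing = rankFuel f rs
... | just c = suc (rankFuel f (map (elimRow r c) rs))

rankF2 : List (List Bool) → ℕ
rankF2 rows = rankFuel (length rows) rows

allFin : (n : ℕ) → List (Fin n)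
allFin zero = []
allFin (suc n) = zero ∷ map suc (allFin n)

subsets : (n : ℕ) → List (Vec Bool n)
subsets zero = [] ∷ []
subsets (suc n) = map (false ∷_) (subsets n) L.++ map (true ∷_) (subsets n)

keep : ∀ {A : Set} → (A → Bool) → List A → List A
keep p [] = []
keep p (a ∷ as) = if p a then a ∷ keep p as else keep p as

members : ∀ {n} → Vec Bool n → List (Fin n)
members {n} W = keep (lookup W) (allFin n)

inducedMatrix : ∀ {n} → Graph n → Vec Bool n → List (List Bool)
inducedMatrix G W = map (λ i → map (λ j → G i j) (members W)) (members W)

nullity : ∀ {n} → Graph n → Vec Bool n → ℕ
nullity G W = length (members W) ∸ rankF2 (inducedMatrix G W)

-- The polynomial q_N(G; x), given by its evaluation at an integer x.

qN : ∀ {n} → Graph n → ℤ → ℤ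
qN {n} G x = foldr ℤ._+_ (ℤ.+ 0)
  (map (λ W → (x ℤ.- ℤ.+ 1) ℤ.^ nullity G W) (subsets n))

addVertex : ∀ {n} → Graph n → (Fin n → Bool) → Graph (suc n)
addVertex G nb zero zero = false
addVertex G nb zero (suc j) = nb j
addVertex G nb (suc i) zero = nb i
addVertex G nb (suc i) (suc j) = G i j

deleteV : ∀ {n} → Graph (suc n) → Fin (suc n) → Graph n
deleteV G u i j = G (punchIn u i) (punchIn u j)

addPendant : ∀ {n} → Graph n → Fin n → Graph (suc n)
addPendant G u = addVertex G (λ j → j == u)

addFalseTwin : ∀ {n} → Graph n → Fin n → Graph (suc n)
addFalseTwin G v = addVertex G (λ j → G v j)

addTrueTwin : ∀ {n} → Graph n → Fin n → Graph (suc n)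
addTrueTwin G v = addVertex G (λ j → G v j ∨ (j == v))

data Cls : Set where
  none Au Av Auv : Cls

cls : ∀ {n} → Graph n → Fin n → Fin n → Fin n → Cls
cls G u v a with (a == u) ∨ (a == v)
... | true = none
... | false with G u a | G v a
...   | true  | false = Au
...   | false | true  = Av
...   | true  | true  = Auv
...   | false | false = none

-- edge of the complete tripartite graph on classes A_u, A_v, A_uv
tri : Cls → Cls → Bool
tri none _ = false
tri _ none = false
tri Au Au = false
tri Av Av = false
tri Auv Auv = false
tri _ _ = true

pivot : ∀ {n} → Graph n → Fin n → Fin n → Graph n
pivot G u v a b = G a b xor tri (cls G u v a) (cls G u v b)

NonIsolated : ∀ {n} → Graph n → Fin n → Set
NonIsolated G v = ∃ λ u → G v u ≡ true

-- Over F₂ a square matrix of nullity d has exactly 2^d kernel vectors. Proved for the elimination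
-- algorithm defining the rank, this turns every nullity identity into an identity between kernel
-- counts, computed one coordinate at a time. In an induced subgraph an isolated vertex, or a false
-- twin w next to v, adds one to the nullity; a pendant vertex w together with its neighbour u, or a
-- true twin w together with v, can be deleted without changing it; a twin w of v can replace v; and
-- for an edge uv a subset containing v but not u has the same nullity in G and in the pivot G^{uv},
-- while one containing both has the nullity of the subset without u and v in G^{uv}. Splitting the
-- subset sum defining q_N by membership of w, u and v gives the three recurrences.
module Submission where

open import Defs
open import Data.Nat using (ℕ; suc)
open import Data.Fin using (Fin; suc)
open import Data.Bool using (true)
open import Data.Product using (_×_)
open import Data.Integer using (ℤ; _+_; _*_; +_)
open import Relation.Binary.PropositionalEquality using (_≡_)

open import Algebra using (CommutativeRing)
import Algebra.Properties.CommutativeSemigroup as CommSemigroupProperties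
open import Data.Bool using (Bool; false; not; _∧_; _∨_; _xor_)
open import Data.Bool.ListAction using (and; all)
open import Data.Bool.Properties
  using ( ∧-assoc; ∧-idem; ∧-zeroʳ; ∧-distribˡ-xor; ∧-distribʳ-xor; ∨-zeroʳ; ∨-identityʳ
        ; xor-assoc; xor-comm; xor-same; xor-identityʳ; xor-∧-commutativeRing )
open import Data.Fin using (zero; _≟_; punchIn; punchOut)
open import Data.Integer using (_-_; _^_)
import Data.Integer.Properties as ℤ
open import Data.Integer.Tactic.RingSolver using (solve-∀)
open import Data.List using (List; []; _∷_; map; length; zipWith; foldr; _++_)
import Data.List.Properties as List
open import Data.List.Relation.Unary.All as All using (All; []; _∷_)
import Data.List.Relation.Unary.All.Properties as All
open import Data.Maybe using (just; nothing)
open import Data.Nat as ℕ using (zero; _∸_; _≤_; _<_; z≤n; s≤s)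
import Data.Nat.Properties as ℕ
open import Data.Product using (_,_; ∃)
open import Data.Vec using (Vec; []; _∷_; lookup; insertAt)
import Data.Vec.Properties as Vec
open import Function using (_∘_)
open import Relation.Binary.Definitions using (tri<; tri≈; tri>)
open import Relation.Binary.PropositionalEquality
  using (_≢_; refl; sym; trans; cong; cong₂; subst; module ≡-Reasoning)
open import Relation.Nullary using (contradiction)
open import Relation.Nullary.Decidable using (dec-true; dec-false)

private
  module Xor = CommSemigroupProperties (CommutativeRing.+-commutativeSemigroup xor-∧-commutativeRing)
  module And = CommSemigroupProperties (CommutativeRing.*-commutativeSemigroup xor-∧-commutativeRing)
  module ℕ+ = CommSemigroupProperties ℕ.+-commutativeSemigroup
  module ℕ* = CommSemigroupProperties ℕ.*-commutativeSemigroup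
  module ℤ+ = CommSemigroupProperties ℤ.+-commutativeSemigroup

xor-cancelˡ : ∀ x y → x xor (x xor y) ≡ y
xor-cancelˡ x y = trans (sym (xor-assoc x x y)) (cong (_xor y) (xor-same x))

∧-xor-factor : ∀ c a b r → (c ∧ a) xor ((c ∧ b) xor r) ≡ (c ∧ (a xor b)) xor r
∧-xor-factor c a b r =
  trans (sym (xor-assoc (c ∧ a) (c ∧ b) r)) (cong (_xor r) (sym (∧-distribˡ-xor c a b)))

not∧-cong : ∀ b {x y} → (b ≡ false → x ≡ y) → not b ∧ x ≡ not b ∧ y
not∧-cong true  _   = refl
not∧-cong false x≡y = cong (true ∧_) (x≡y refl)

all-cong-local : ∀ {A : Set} {f g : A → Bool} {xs} → All (λ x → f x ≡ g x) xs → all f xs ≡ all g xs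
all-cong-local = cong and ∘ List.map-cong-local

insertAtℕ : ∀ {A : Set} → List A → ℕ → A → List A
insertAtℕ xs       zero    v = v ∷ xs
insertAtℕ []       (suc p) v = v ∷ []
insertAtℕ (x ∷ xs) (suc p) v = x ∷ insertAtℕ xs p v

length-insertAtℕ : ∀ {A : Set} (xs : List A) p v → length (insertAtℕ xs p v) ≡ suc (length xs)
length-insertAtℕ xs       zero    v = refl
length-insertAtℕ []       (suc p) v = refl
length-insertAtℕ (x ∷ xs) (suc p) v = cong suc (length-insertAtℕ xs p v)

map-insertAtℕ : ∀ {A B : Set} (f : A → B) xs p v →
  map f (insertAtℕ xs p v) ≡ insertAtℕ (map f xs) p (f v)
map-insertAtℕ f xs       zero    v = refl
map-insertAtℕ f []       (suc p) v = refl
map-insertAtℕ f (x ∷ xs) (suc p) v = cong (f x ∷_) (map-insertAtℕ f xs p v)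

all-insertAtℕ : ∀ {A : Set} (f : A → Bool) xs p v → all f (insertAtℕ xs p v) ≡ f v ∧ all f xs
all-insertAtℕ f xs       zero    v = refl
all-insertAtℕ f []       (suc p) v = refl
all-insertAtℕ f (x ∷ xs) (suc p) v =
  trans (cong (f x ∧_) (all-insertAtℕ f xs p v)) (And.x∙yz≈y∙xz (f x) (f v) (all f xs))

dot : List Bool → List Bool → Bool
dot (r ∷ rs) (y ∷ ys) = (r ∧ y) xor dot rs ys
dot _        _        = false

dot-zipWith-xor : ∀ (s r y : List Bool) → length s ≡ length r →
  dot (zipWith _xor_ s r) y ≡ dot s y xor dot r y
dot-zipWith-xor []      []      y       _  = refl
dot-zipWith-xor (a ∷ s) (b ∷ r) []      _  = refl
dot-zipWith-xor (a ∷ s) (b ∷ r) (c ∷ y) eq = begin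
  ((a xor b) ∧ c) xor dot (zipWith _xor_ s r) y
    ≡⟨ cong₂ _xor_ (∧-distribʳ-xor c a b) (dot-zipWith-xor s r y (ℕ.suc-injective eq)) ⟩
  ((a ∧ c) xor (b ∧ c)) xor (dot s y xor dot r y)
    ≡⟨ Xor.interchange (a ∧ c) (b ∧ c) (dot s y) (dot r y) ⟩
  ((a ∧ c) xor dot s y) xor ((b ∧ c) xor dot r y) ∎
  where open ≡-Reasoning

map-xor : ∀ {A : Set} (f g : A → Bool) xs → map (λ x → f x xor g x) xs ≡ zipWith _xor_ (map f xs) (map g xs)
map-xor f g []       = refl
map-xor f g (x ∷ xs) = cong ((f x xor g x) ∷_) (map-xor f g xs)

dot-map-xor : ∀ {A : Set} (f g : A → Bool) xs y →
  dot (map (λ x → f x xor g x) xs) y ≡ dot (map f xs) y xor dot (map g xs) y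
dot-map-xor f g xs y = trans (cong (λ r → dot r y) (map-xor f g xs))
  (dot-zipWith-xor (map f xs) (map g xs) y (trans (List.length-map f xs) (sym (List.length-map g xs))))

dot-map-∧ : ∀ {A : Set} c (f : A → Bool) xs y → dot (map (λ x → c ∧ f x) xs) y ≡ c ∧ dot (map f xs) y
dot-map-∧ c f []       y       = sym (∧-zeroʳ c)
dot-map-∧ c f (x ∷ xs) []      = sym (∧-zeroʳ c)
dot-map-∧ c f (x ∷ xs) (b ∷ y) = begin
  ((c ∧ f x) ∧ b) xor dot (map (λ x → c ∧ f x) xs) y  ≡⟨ cong₂ _xor_ (∧-assoc c (f x) b) (dot-map-∧ c f xs y) ⟩
  (c ∧ (f x ∧ b)) xor (c ∧ dot (map f xs) y)          ≡⟨ ∧-distribˡ-xor c (f x ∧ b) (dot (map f xs) y) ⟨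
  c ∧ ((f x ∧ b) xor dot (map f xs) y)                ∎
  where open ≡-Reasoning

dot-map-cong : ∀ {A : Set} {f g : A → Bool} {xs} y → All (λ x → f x ≡ g x) xs →
  dot (map f xs) y ≡ dot (map g xs) y
dot-map-cong y f≡g = cong (λ r → dot r y) (List.map-cong-local f≡g)

dot-map-false : ∀ {A : Set} {f : A → Bool} {xs} y → All (λ x → f x ≡ false) xs → dot (map f xs) y ≡ false
dot-map-false y       []         = refl
dot-map-false []      (_ ∷ _)    = refl
dot-map-false (b ∷ y) (fx ∷ f≡0) rewrite fx = dot-map-false y f≡0

dot-insertAtℕ : ∀ r y p c b → length r ≡ length y →
  dot (insertAtℕ r p c) (insertAtℕ y p b) ≡ (c ∧ b) xor dot r y
dot-insertAtℕ r       y       zero    c b _  = refl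
dot-insertAtℕ []      []      (suc p) c b _  = refl
dot-insertAtℕ (a ∷ r) (x ∷ y) (suc p) c b eq =
  trans (cong ((a ∧ x) xor_) (dot-insertAtℕ r y p c b (ℕ.suc-injective eq)))
        (Xor.x∙yz≈y∙xz (a ∧ x) (c ∧ b) (dot r y))

dot-insertAtℕʳ : ∀ r y p b → p ≤ length y →
  dot r (insertAtℕ y p b) ≡ (at r p ∧ b) xor dot r (insertAtℕ y p false)
dot-insertAtℕʳ []      y       p       b _ = refl
dot-insertAtℕʳ (a ∷ r) y       zero    b _ = cong (λ t → (a ∧ b) xor (t xor dot r y)) (sym (∧-zeroʳ a))
dot-insertAtℕʳ (a ∷ r) (x ∷ y) (suc p) b (s≤s p≤∣y∣) =
  trans (cong ((a ∧ x) xor_) (dot-insertAtℕʳ r y p b p≤∣y∣))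
        (Xor.x∙yz≈y∙xz (a ∧ x) (at r p ∧ b) (dot r (insertAtℕ y p false)))

-- Sums over the Boolean cube

⟦_⟧ : Bool → ℕ
⟦ true  ⟧ = 1
⟦ false ⟧ = 0

Σ𝔹 : (Bool → ℕ) → ℕ
Σ𝔹 f = f false ℕ.+ f true

Σ𝔹-cong : ∀ {f g : Bool → ℕ} → (∀ a → f a ≡ g a) → Σ𝔹 f ≡ Σ𝔹 g
Σ𝔹-cong f≡g = cong₂ ℕ._+_ (f≡g false) (f≡g true)

Σ𝔹-const : ∀ n → Σ𝔹 (λ _ → n) ≡ 2 ℕ.* n
Σ𝔹-const n = cong (n ℕ.+_) (sym (ℕ.+-identityʳ n))

Σ𝔹-shift : ∀ α (f : Bool → ℕ) → Σ𝔹 (λ a → f (a xor α)) ≡ Σ𝔹 f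
Σ𝔹-shift false f = refl
Σ𝔹-shift true  f = ℕ.+-comm (f true) (f false)

Σ𝔹-solve : ∀ c α (P : Bool → Bool) → Σ𝔹 (λ a → ⟦ c ∧ (not (a xor α) ∧ P a) ⟧) ≡ ⟦ c ∧ P α ⟧
Σ𝔹-solve false α     P = refl
Σ𝔹-solve true  false P = ℕ.+-identityʳ ⟦ P false ⟧
Σ𝔹-solve true  true  P = refl

Σ𝔹-comm : ∀ (f : Bool → Bool → ℕ) → Σ𝔹 (λ a → Σ𝔹 (f a)) ≡ Σ𝔹 (λ b → Σ𝔹 (λ a → f a b))
Σ𝔹-comm f = ℕ+.interchange (f false false) (f false true) (f true false) (f true true)

-- The head coordinate is summed innermost, so that the kernel count of a vertex list v ∷ L is by
-- definition a sum, over the coordinates of L, of two-term sums over the coordinate of v.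
cubeSum : ℕ → (List Bool → ℕ) → ℕ
cubeSum zero    f = f []
cubeSum (suc k) f = cubeSum k (λ y → Σ𝔹 (λ a → f (a ∷ y)))

cubeSum-cong : ∀ k {f g : List Bool → ℕ} → (∀ y → length y ≡ k → f y ≡ g y) → cubeSum k f ≡ cubeSum k g
cubeSum-cong zero    f≡g = f≡g [] refl
cubeSum-cong (suc k) f≡g = cubeSum-cong k (λ y eq → Σ𝔹-cong (λ a → f≡g (a ∷ y) (cong suc eq)))

cubeSum-* : ∀ k c (f : List Bool → ℕ) → cubeSum k (λ y → c ℕ.* f y) ≡ c ℕ.* cubeSum k f
cubeSum-* zero    c f = refl
cubeSum-* (suc k) c f = trans
  (cubeSum-cong k (λ y _ → sym (ℕ.*-distribˡ-+ c (f (false ∷ y)) (f (true ∷ y)))))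
  (cubeSum-* k c (λ y → Σ𝔹 (λ a → f (a ∷ y))))

cubeSum-const : ∀ k c → cubeSum k (λ _ → c) ≡ 2 ℕ.^ k ℕ.* c
cubeSum-const zero    c = sym (ℕ.+-identityʳ c)
cubeSum-const (suc k) c = begin
  cubeSum k (λ _ → c ℕ.+ c)   ≡⟨ cubeSum-const k (c ℕ.+ c) ⟩
  2 ℕ.^ k ℕ.* (c ℕ.+ c)       ≡⟨ cong (2 ℕ.^ k ℕ.*_) (Σ𝔹-const c) ⟩
  2 ℕ.^ k ℕ.* (2 ℕ.* c)       ≡⟨ ℕ*.x∙yz≈y∙xz (2 ℕ.^ k) 2 c ⟩
  2 ℕ.* (2 ℕ.^ k ℕ.* c)       ≡⟨ ℕ.*-assoc 2 (2 ℕ.^ k) c ⟨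
  2 ℕ.^ suc k ℕ.* c           ∎
  where open ≡-Reasoning

cubeSum-insertAtℕ : ∀ k p (f : List Bool → ℕ) →
  cubeSum (suc k) f ≡ cubeSum k (λ y → Σ𝔹 (λ a → f (insertAtℕ y p a)))
cubeSum-insertAtℕ k       zero    f = refl
cubeSum-insertAtℕ zero    (suc p) f = refl
cubeSum-insertAtℕ (suc k) (suc p) f = trans
  (cubeSum-insertAtℕ k p (λ y → Σ𝔹 (λ a → f (a ∷ y))))
  (cubeSum-cong k (λ y _ → Σ𝔹-comm (λ b a → f (a ∷ insertAtℕ y p b))))

-- Kernel size and F₂-rank

inKernel : List (List Bool) → List Bool → Bool
inKernel rows y = all (λ r → not (dot r y)) rows

kernelSize : ℕ → List (List Bool) → ℕ
kernelSize k rows = cubeSum k (λ y → ⟦ inKernel rows y ⟧)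

firstTrue-nothing : ∀ r → firstTrue r ≡ nothing → ∀ y → dot r y ≡ false
firstTrue-nothing []          _  y       = refl
firstTrue-nothing (true ∷ r)  () y
firstTrue-nothing (false ∷ r) _  []      = refl
firstTrue-nothing (false ∷ r) eq (b ∷ y) with firstTrue r in eq′
... | nothing = firstTrue-nothing r eq′ y
firstTrue-nothing (false ∷ r) () (b ∷ y) | just _

firstTrue-just : ∀ r {c} → firstTrue r ≡ just c → at r c ≡ true × c < length r
firstTrue-just (true ∷ r)  refl = refl , s≤s z≤n
firstTrue-just (false ∷ r) eq with firstTrue r in eq′
firstTrue-just (false ∷ r) ()   | nothing
firstTrue-just (false ∷ r) refl | just c with firstTrue-just r eq′
... | r[c] , c<∣r∣ = r[c] , s≤s c<∣r∣

at-zipWith-xor : ∀ (s r : List Bool) c → length s ≡ length r → at (zipWith _xor_ s r) c ≡ at s c xor at r c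
at-zipWith-xor []      []      c       _  = refl
at-zipWith-xor (a ∷ s) (b ∷ r) zero    _  = refl
at-zipWith-xor (a ∷ s) (b ∷ r) (suc c) eq = at-zipWith-xor s r c (ℕ.suc-injective eq)

length-elimRow : ∀ r c s → length s ≡ length r → length (elimRow r c s) ≡ length s
length-elimRow r c s eq with at s c
... | true  = trans (List.length-zipWith _xor_ s r) (trans (cong (length s ℕ.⊓_) (sym eq)) (ℕ.⊓-idem _))
... | false = refl

at-elimRow : ∀ r c s → length s ≡ length r → at r c ≡ true → at (elimRow r c s) c ≡ false
at-elimRow r c s eq r[c] with at s c in s[c]
... | true  = trans (at-zipWith-xor s r c eq) (cong₂ _xor_ s[c] r[c])
... | false = s[c]

dot-elimRow : ∀ r c s y → length s ≡ length r → dot (elimRow r c s) y ≡ dot s y xor (at s c ∧ dot r y)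
dot-elimRow r c s y eq with at s c
... | true  = dot-zipWith-xor s r y eq
... | false = sym (xor-identityʳ (dot s y))

inKernel-elimRow : ∀ r c {rows} y → dot r y ≡ false → All (λ s → length s ≡ length r) rows →
  inKernel (map (elimRow r c) rows) y ≡ inKernel rows y
inKernel-elimRow r c           y r·y≡0 []          = refl
inKernel-elimRow r c {s ∷ rows} y r·y≡0 (eq ∷ eqs) = cong₂ (λ t u → not t ∧ u)
  (begin
    dot (elimRow r c s) y            ≡⟨ dot-elimRow r c s y eq ⟩
    dot s y xor (at s c ∧ dot r y)   ≡⟨ cong (λ t → dot s y xor (at s c ∧ t)) r·y≡0 ⟩
    dot s y xor (at s c ∧ false)     ≡⟨ cong (dot s y xor_) (∧-zeroʳ (at s c)) ⟩
    dot s y xor false                ≡⟨ xor-identityʳ (dot s y) ⟩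
    dot s y                          ∎)
  (inKernel-elimRow r c y r·y≡0 eqs)
  where open ≡-Reasoning

inKernel-eliminate : ∀ r c rows y → All (λ s → length s ≡ length r) rows →
  inKernel (r ∷ map (elimRow r c) rows) y ≡ inKernel (r ∷ rows) y
inKernel-eliminate r c rows y eqs = not∧-cong (dot r y) (λ r·y≡0 → inKernel-elimRow r c y r·y≡0 eqs)

-- Column c is zero outside the pivot row r, so the equation of r determines coordinate c.
kernelSize-halve : ∀ k c r R → at r c ≡ true → c ≤ k → All (λ s → at s c ≡ false) R →
  2 ℕ.* kernelSize (suc k) (r ∷ R) ≡ kernelSize (suc k) R
kernelSize-halve k c r R r[c] c≤k R[c] = begin
  2 ℕ.* kernelSize (suc k) (r ∷ R)
    ≡⟨ cong (2 ℕ.*_) (cubeSum-insertAtℕ k c (λ y → ⟦ inKernel (r ∷ R) y ⟧)) ⟩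
  2 ℕ.* cubeSum k (λ z → Σ𝔹 (λ b → ⟦ inKernel (r ∷ R) (insertAtℕ z c b) ⟧))
    ≡⟨ cong (2 ℕ.*_) (cubeSum-cong k fibre-r) ⟩
  2 ℕ.* cubeSum k (λ z → ⟦ Q z ⟧)
    ≡⟨ cubeSum-* k 2 (λ z → ⟦ Q z ⟧) ⟨
  cubeSum k (λ z → 2 ℕ.* ⟦ Q z ⟧)
    ≡⟨ cubeSum-cong k fibre-R ⟨
  cubeSum k (λ z → Σ𝔹 (λ b → ⟦ inKernel R (insertAtℕ z c b) ⟧))
    ≡⟨ cubeSum-insertAtℕ k c (λ y → ⟦ inKernel R y ⟧) ⟨
  kernelSize (suc k) R ∎
  where
  open ≡-Reasoning
  Q : List Bool → Bool
  Q z = inKernel R (insertAtℕ z c false)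
  c≤∣_∣ : ∀ z → length z ≡ k → c ≤ length z
  c≤∣ z ∣ ∣z∣≡k = subst (c ≤_) (sym ∣z∣≡k) c≤k
  R-indep : ∀ z → c ≤ length z → ∀ b {R′} → All (λ s → at s c ≡ false) R′ →
    inKernel R′ (insertAtℕ z c b) ≡ inKernel R′ (insertAtℕ z c false)
  R-indep z c≤∣z∣ b []                   = refl
  R-indep z c≤∣z∣ b {s ∷ R′} (s[c] ∷ R′[c]) = cong₂ (λ t u → not t ∧ u)
    (trans (dot-insertAtℕʳ s z c b c≤∣z∣) (cong (λ t → (t ∧ b) xor dot s (insertAtℕ z c false)) s[c]))
    (R-indep z c≤∣z∣ b R′[c])
  fibre-r : ∀ z → length z ≡ k → Σ𝔹 (λ b → ⟦ inKernel (r ∷ R) (insertAtℕ z c b) ⟧) ≡ ⟦ Q z ⟧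
  fibre-r z ∣z∣≡k = trans (Σ𝔹-cong (λ b → cong ⟦_⟧ (row b))) (Σ𝔹-solve true ρ (λ _ → Q z))
    where
    ρ : Bool
    ρ = dot r (insertAtℕ z c false)
    row : ∀ b → inKernel (r ∷ R) (insertAtℕ z c b) ≡ not (b xor ρ) ∧ Q z
    row b = cong₂ (λ t u → not t ∧ u)
      (trans (dot-insertAtℕʳ r z c b (c≤∣ z ∣ ∣z∣≡k)) (cong (λ t → (t ∧ b) xor ρ) r[c]))
      (R-indep z (c≤∣ z ∣ ∣z∣≡k) b R[c])
  fibre-R : ∀ z → length z ≡ k → Σ𝔹 (λ b → ⟦ inKernel R (insertAtℕ z c b) ⟧) ≡ 2 ℕ.* ⟦ Q z ⟧
  fibre-R z ∣z∣≡k = trans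
    (cong (λ t → ⟦ Q z ⟧ ℕ.+ ⟦ t ⟧) (R-indep z (c≤∣ z ∣ ∣z∣≡k) true R[c]))
    (Σ𝔹-const ⟦ Q z ⟧)

kernelSize-pivot : ∀ {k} r c rows → at r c ≡ true → c < k → All (λ s → length s ≡ length r) rows →
  2 ℕ.* kernelSize k (r ∷ rows) ≡ kernelSize k (map (elimRow r c) rows)
kernelSize-pivot {suc k} r c rows r[c] (s≤s c≤k) eqs = trans
  (cong (2 ℕ.*_) (cubeSum-cong (suc k) (λ y _ → cong ⟦_⟧ (sym (inKernel-eliminate r c rows y eqs)))))
  (kernelSize-halve k c r (map (elimRow r c) rows) r[c] c≤k
    (All.map⁺ (All.map (λ {s} eq → at-elimRow r c s eq r[c]) eqs)))

2^rankFuel*kernelSize≡2^k : ∀ {k} f rows → length rows ≡ f → All (λ r → length r ≡ k) rows →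
  2 ℕ.^ rankFuel f rows ℕ.* kernelSize k rows ≡ 2 ℕ.^ k
2^rankFuel*kernelSize≡2^k {k} zero [] _ _ =
  trans (ℕ.+-identityʳ _) (trans (cubeSum-const k 1) (ℕ.*-identityʳ _))
2^rankFuel*kernelSize≡2^k {k} (suc f) (r ∷ rows) ∣r∷rows∣ (∣r∣ ∷ ∣rows∣) with firstTrue r in eq
... | nothing = trans
  (cong (2 ℕ.^ rankFuel f rows ℕ.*_) (cubeSum-cong k (λ y _ →
    cong (λ t → ⟦ not t ∧ inKernel rows y ⟧) (firstTrue-nothing r eq y))))
  (2^rankFuel*kernelSize≡2^k f rows (ℕ.suc-injective ∣r∷rows∣) ∣rows∣)
... | just c = begin
  (2 ℕ.* 2 ℕ.^ t) ℕ.* kernelSize k (r ∷ rows)   ≡⟨ ℕ.*-assoc 2 (2 ℕ.^ t) _ ⟩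
  2 ℕ.* (2 ℕ.^ t ℕ.* kernelSize k (r ∷ rows))   ≡⟨ ℕ*.x∙yz≈y∙xz 2 (2 ℕ.^ t) _ ⟩
  2 ℕ.^ t ℕ.* (2 ℕ.* kernelSize k (r ∷ rows))   ≡⟨ cong (2 ℕ.^ t ℕ.*_) pivot-halves ⟩
  2 ℕ.^ t ℕ.* kernelSize k rows′                ≡⟨ 2^rankFuel*kernelSize≡2^k f rows′ ∣rows′∣≡f ∣rows′∣ ⟩
  2 ℕ.^ k                                      ∎
  where
  open ≡-Reasoning
  rows′ : List (List Bool)
  rows′ = map (elimRow r c) rows
  t : ℕ
  t = rankFuel f rows′
  eqs : All (λ s → length s ≡ length r) rows
  eqs = All.map (λ ∣s∣ → trans ∣s∣ (sym ∣r∣)) ∣rows∣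
  ∣rows′∣≡f : length rows′ ≡ f
  ∣rows′∣≡f = trans (List.length-map (elimRow r c) rows) (ℕ.suc-injective ∣r∷rows∣)
  ∣rows′∣ : All (λ s → length s ≡ k) rows′
  ∣rows′∣ = All.map⁺ (All.zipWith (λ {s} (∣s∣ , eq) → trans (length-elimRow r c s eq) ∣s∣) (∣rows∣ , eqs))
  pivot-halves : 2 ℕ.* kernelSize k (r ∷ rows) ≡ kernelSize k rows′
  pivot-halves with firstTrue-just r eq
  ... | r[c] , c<∣r∣ = kernelSize-pivot r c rows r[c] (subst (c <_) ∣r∣ c<∣r∣) eqs

rankFuel≤ : ∀ f rows → rankFuel f rows ≤ f
rankFuel≤ zero    rows       = z≤n
rankFuel≤ (suc f) []         = z≤n
rankFuel≤ (suc f) (r ∷ rows) with firstTrue r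
... | nothing = ℕ.m≤n⇒m≤1+n (rankFuel≤ f rows)
... | just c  = s≤s (rankFuel≤ f (map (elimRow r c) rows))

kernelSize≡2^[k∸rank] : ∀ k M → length M ≡ k → All (λ r → length r ≡ k) M →
  kernelSize k M ≡ 2 ℕ.^ (k ∸ rankF2 M)
kernelSize≡2^[k∸rank] k M ∣M∣ ∣rows∣ = ℕ.*-cancelˡ-≡ _ _ (2 ℕ.^ rank) {{ℕ.m^n≢0 2 rank}} (begin
  2 ℕ.^ rank ℕ.* kernelSize k M         ≡⟨ 2^rankFuel*kernelSize≡2^k (length M) M refl ∣rows∣ ⟩
  2 ℕ.^ k                              ≡⟨ cong (2 ℕ.^_) (ℕ.m+[n∸m]≡n rank≤k) ⟨
  2 ℕ.^ (rank ℕ.+ (k ∸ rank))          ≡⟨ ℕ.^-distribˡ-+-* 2 rank (k ∸ rank) ⟩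
  2 ℕ.^ rank ℕ.* 2 ℕ.^ (k ∸ rank)      ∎)
  where
  open ≡-Reasoning
  rank : ℕ
  rank = rankF2 M
  rank≤k : rank ≤ k
  rank≤k = subst (rank ≤_) ∣M∣ (rankFuel≤ (length M) M)

-- Nullity of induced subgraphs on vertex lists

rowsOn : ∀ {n} → Graph n → List (Fin n) → List (List Bool)
rowsOn G L = map (λ i → map (G i) L) L

nullityOn : ∀ {n} → Graph n → List (Fin n) → ℕ
nullityOn G L = length L ∸ rankF2 (rowsOn G L)

inKernelOn : ∀ {n} → Graph n → List (Fin n) → List Bool → Bool
inKernelOn G L y = all (λ i → not (dot (map (G i) L) y)) L

kernelCount : ∀ {n} → Graph n → List (Fin n) → ℕ
kernelCount G L = cubeSum (length L) (λ y → ⟦ inKernelOn G L y ⟧)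

kernelCount≡2^nullityOn : ∀ {n} (G : Graph n) L → kernelCount G L ≡ 2 ℕ.^ nullityOn G L
kernelCount≡2^nullityOn G L = trans
  (cubeSum-cong (length L) (λ y _ → cong (λ t → ⟦ and t ⟧) (List.map-∘ L)))
  (kernelSize≡2^[k∸rank] (length L) (rowsOn G L) (List.length-map _ L)
    (All.map⁺ (All.universal (λ i → List.length-map (G i) L) L)))

2^-injective : ∀ {m n} → 2 ℕ.^ m ≡ 2 ℕ.^ n → m ≡ n
2^-injective {m} {n} eq with ℕ.<-cmp m n
... | tri< m<n _ _ = contradiction eq (ℕ.<⇒≢ (ℕ.^-monoʳ-< 2 (s≤s (s≤s z≤n)) m<n))
... | tri≈ _ m≡n _ = m≡n
... | tri> _ _ n<m = contradiction (sym eq) (ℕ.<⇒≢ (ℕ.^-monoʳ-< 2 (s≤s (s≤s z≤n)) n<m))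

nullityOn-cong : ∀ {m n} (G : Graph m) L (H : Graph n) M →
  kernelCount G L ≡ kernelCount H M → nullityOn G L ≡ nullityOn H M
nullityOn-cong G L H M eq = 2^-injective (begin
  2 ℕ.^ nullityOn G L   ≡⟨ kernelCount≡2^nullityOn G L ⟨
  kernelCount G L       ≡⟨ eq ⟩
  kernelCount H M       ≡⟨ kernelCount≡2^nullityOn H M ⟩
  2 ℕ.^ nullityOn H M   ∎)
  where open ≡-Reasoning

nullityOn-suc : ∀ {m n} (G : Graph m) L (H : Graph n) M →
  kernelCount G L ≡ 2 ℕ.* kernelCount H M → nullityOn G L ≡ suc (nullityOn H M)
nullityOn-suc G L H M eq = 2^-injective (begin
  2 ℕ.^ nullityOn G L         ≡⟨ kernelCount≡2^nullityOn G L ⟨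
  kernelCount G L             ≡⟨ eq ⟩
  2 ℕ.* kernelCount H M       ≡⟨ cong (2 ℕ.*_) (kernelCount≡2^nullityOn H M) ⟩
  2 ℕ.^ suc (nullityOn H M)   ∎)
  where open ≡-Reasoning

nullityOn-map : ∀ {m n} (G : Graph n) (f : Fin m → Fin n) L →
  nullityOn (λ i j → G (f i) (f j)) L ≡ nullityOn G (map f L)
nullityOn-map G f L = cong₂ _∸_ (sym (List.length-map f L))
  (cong rankF2 (trans (List.map-cong (λ i → List.map-∘ L) L) (List.map-∘ L)))

-- Kernel vectors correspond by moving the coordinate of v along with v.
nullityOn-insertAtℕ : ∀ {n} (G : Graph n) L p v → nullityOn G (insertAtℕ L p v) ≡ nullityOn G (v ∷ L)
nullityOn-insertAtℕ G L p v = nullityOn-cong G L′ G (v ∷ L) (begin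
  kernelCount G L′
    ≡⟨ cong (λ k → cubeSum k (λ y → ⟦ inKernelOn G L′ y ⟧)) (length-insertAtℕ L p v) ⟩
  cubeSum (suc (length L)) (λ y → ⟦ inKernelOn G L′ y ⟧)
    ≡⟨ cubeSum-insertAtℕ (length L) p (λ y → ⟦ inKernelOn G L′ y ⟧) ⟩
  cubeSum (length L) (λ z → Σ𝔹 (λ a → ⟦ inKernelOn G L′ (insertAtℕ z p a) ⟧))
    ≡⟨ cubeSum-cong (length L) (λ z ∣z∣ → Σ𝔹-cong (λ a → cong ⟦_⟧ (moved z ∣z∣ a))) ⟩
  kernelCount G (v ∷ L) ∎)
  where
  open ≡-Reasoning
  L′ : List (Fin _)
  L′ = insertAtℕ L p v
  row : ∀ z → length z ≡ length L → ∀ a i →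
    dot (map (G i) L′) (insertAtℕ z p a) ≡ (G i v ∧ a) xor dot (map (G i) L) z
  row z ∣z∣ a i = trans (cong (λ r → dot r (insertAtℕ z p a)) (map-insertAtℕ (G i) L p v))
    (dot-insertAtℕ (map (G i) L) z p (G i v) a (trans (List.length-map (G i) L) (sym ∣z∣)))
  moved : ∀ z → length z ≡ length L → ∀ a → inKernelOn G L′ (insertAtℕ z p a) ≡ inKernelOn G (v ∷ L) (a ∷ z)
  moved z ∣z∣ a = trans (all-insertAtℕ _ L p v) (cong₂ _∧_ (cong not (row z ∣z∣ a v))
    (cong and (List.map-cong (λ i → cong not (row z ∣z∣ a i)) L)))

-- Pivoting

clsOf : Bool → Bool → Cls
clsOf false false = none
clsOf true  false = Au
clsOf false true  = Av
clsOf true  true  = Auv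

tri-clsOf : ∀ a b c d → tri (clsOf a b) (clsOf c d) ≡ (a ∧ d) xor (b ∧ c)
tri-clsOf false false c     d     = refl
tri-clsOf true  false false false = refl
tri-clsOf true  false true  false = refl
tri-clsOf true  false false true  = refl
tri-clsOf true  false true  true  = refl
tri-clsOf false true  false false = refl
tri-clsOf false true  true  false = refl
tri-clsOf false true  false true  = refl
tri-clsOf false true  true  true  = refl
tri-clsOf true  true  false false = refl
tri-clsOf true  true  true  false = refl
tri-clsOf true  true  false true  = refl
tri-clsOf true  true  true  true  = refl

tri-none : ∀ c → tri c none ≡ false
tri-none none = refl
tri-none Au   = refl
tri-none Av   = refl
tri-none Auv  = refl

module _ {n} (G : Graph n) (u v : Fin n) where

  cls-v : cls G u v v ≡ none
  cls-v with (v == u) ∨ (v == v) | trans (cong ((v == u) ∨_) (dec-true (v ≟ v) refl)) (∨-zeroʳ (v == u))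
  ... | true | _ = refl

  cls-outside : ∀ {i} → i ≢ u → i ≢ v → cls G u v i ≡ clsOf (G u i) (G v i)
  cls-outside {i} i≢u i≢v with (i == u) ∨ (i == v) | cong₂ _∨_ (dec-false (i ≟ u) i≢u) (dec-false (i ≟ v) i≢v)
  ... | false | _ with G u i | G v i
  ...   | false | false = refl
  ...   | true  | false = refl
  ...   | false | true  = refl
  ...   | true  | true  = refl

  pivot-row-v : ∀ j → pivot G u v v j ≡ G v j
  pivot-row-v j = trans (cong (λ c → G v j xor tri c (cls G u v j)) cls-v) (xor-identityʳ (G v j))

  pivot-col-v : ∀ i → pivot G u v i v ≡ G i v
  pivot-col-v i = trans (cong (λ c → G i v xor tri (cls G u v i) c) cls-v)
    (trans (cong (G i v xor_) (tri-none (cls G u v i))) (xor-identityʳ (G i v)))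

  pivot-outside : ∀ {i j} → i ≢ u → i ≢ v → j ≢ u → j ≢ v →
    pivot G u v i j ≡ G i j xor ((G u i ∧ G v j) xor (G v i ∧ G u j))
  pivot-outside {i} {j} i≢u i≢v j≢u j≢v = cong (G i j xor_) (trans
    (cong₂ tri (cls-outside i≢u i≢v) (cls-outside j≢u j≢v)) (tri-clsOf (G u i) (G v i) (G u j) (G v j)))

  dot-pivot : ∀ {i} L z → i ≢ u → i ≢ v → All (_≢ u) L → All (_≢ v) L →
    dot (map (pivot G u v i) L) z
      ≡ dot (map (G i) L) z xor ((G u i ∧ dot (map (G v) L) z) xor (G v i ∧ dot (map (G u) L) z))
  dot-pivot {i} L z i≢u i≢v L∌u L∌v = begin
    dot (map (pivot G u v i) L) z
      ≡⟨ dot-map-cong z (All.zipWith (λ (j≢u , j≢v) → pivot-outside i≢u i≢v j≢u j≢v) (L∌u , L∌v)) ⟩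
    dot (map (λ j → G i j xor ((G u i ∧ G v j) xor (G v i ∧ G u j))) L) z
      ≡⟨ dot-map-xor (G i) (λ j → (G u i ∧ G v j) xor (G v i ∧ G u j)) L z ⟩
    ρ i xor dot (map (λ j → (G u i ∧ G v j) xor (G v i ∧ G u j)) L) z
      ≡⟨ cong (ρ i xor_) (dot-map-xor (λ j → G u i ∧ G v j) (λ j → G v i ∧ G u j) L z) ⟩
    ρ i xor (dot (map (λ j → G u i ∧ G v j) L) z xor dot (map (λ j → G v i ∧ G u j) L) z)
      ≡⟨ cong (ρ i xor_) (cong₂ _xor_ (dot-map-∧ (G u i) (G v) L z) (dot-map-∧ (G v i) (G u) L z)) ⟩
    ρ i xor ((G u i ∧ ρ v) xor (G v i ∧ ρ u)) ∎
    where
    open ≡-Reasoning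
    ρ : Fin n → Bool
    ρ k = dot (map (G k) L) z

-- Local moves in simple graphs

module _ {n} (G : Graph n) (simple : IsSimple G) where
  open IsSimple simple renaming (sym to symmetric; irrefl to loopless)

  private
    ρ : Fin n → List (Fin n) → List Bool → Bool
    ρ i L z = dot (map (G i) L) z

    column : ∀ {v w} L → All (λ j → G w j ≡ G v j) L → All (λ i → G i w ≡ G i v) L
    column L = All.map (λ {i} w≈v[i] → trans (symmetric i _) (trans w≈v[i] (symmetric _ i)))

  nullityOn-isolated : ∀ w L → All (λ j → G w j ≡ false) L → nullityOn G (w ∷ L) ≡ suc (nullityOn G L)
  nullityOn-isolated w L w↛L = nullityOn-suc G (w ∷ L) G L (trans
    (cubeSum-cong (length L) (λ z _ →
      trans (Σ𝔹-cong (λ a → cong ⟦_⟧ (isolated z a))) (Σ𝔹-const ⟦ inKernelOn G L z ⟧)))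
    (cubeSum-* (length L) 2 (λ z → ⟦ inKernelOn G L z ⟧)))
    where
    isolated : ∀ z a → inKernelOn G (w ∷ L) (a ∷ z) ≡ inKernelOn G L z
    isolated z a rewrite loopless w | dot-map-false z w↛L = all-cong-local
      (All.map (λ {i} w↛i → cong (λ t → not ((t ∧ a) xor ρ i L z)) (trans (symmetric i w) w↛i)) w↛L)

  nullityOn-pendant : ∀ u w L → G w u ≡ true → All (λ j → G w j ≡ false) L →
    nullityOn G (u ∷ w ∷ L) ≡ nullityOn G L
  nullityOn-pendant u w L w→u w↛L = nullityOn-cong G (u ∷ w ∷ L) G L (cubeSum-cong (length L) fibre)
    where
    R : List Bool → Bool → Bool
    R z a = all (λ i → not ((G i u ∧ a) xor ρ i L z)) L
    K : ∀ z a b → inKernelOn G (u ∷ w ∷ L) (a ∷ b ∷ z) ≡ not (b xor ρ u L z) ∧ (not (a xor false) ∧ R z a)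
    K z a b rewrite loopless u | loopless w | symmetric u w | w→u | dot-map-false z w↛L =
      cong (λ t → not (b xor ρ u L z) ∧ (not (a xor false) ∧ t)) (all-cong-local
        (All.map (λ {i} w↛i → cong (λ t → not ((G i u ∧ a) xor ((t ∧ b) xor ρ i L z)))
                                   (trans (symmetric i w) w↛i)) w↛L))
    fibre : ∀ z → length z ≡ length L →
      Σ𝔹 (λ b → Σ𝔹 (λ a → ⟦ inKernelOn G (u ∷ w ∷ L) (a ∷ b ∷ z) ⟧)) ≡ ⟦ inKernelOn G L z ⟧
    fibre z _ = begin
      Σ𝔹 (λ b → Σ𝔹 (λ a → ⟦ inKernelOn G (u ∷ w ∷ L) (a ∷ b ∷ z) ⟧))
        ≡⟨ Σ𝔹-cong (λ b → trans (Σ𝔹-cong (λ a → cong ⟦_⟧ (K z a b)))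
                                (Σ𝔹-solve (not (b xor ρ u L z)) false (R z))) ⟩
      Σ𝔹 (λ b → ⟦ not (b xor ρ u L z) ∧ R z false ⟧)
        ≡⟨ Σ𝔹-solve true (ρ u L z) (λ _ → R z false) ⟩
      ⟦ R z false ⟧
        ≡⟨ cong ⟦_⟧ (cong and (List.map-cong (λ i → cong (λ t → not (t xor ρ i L z)) (∧-zeroʳ (G i u))) L)) ⟩
      ⟦ inKernelOn G L z ⟧ ∎
      where open ≡-Reasoning

  nullityOn-twin : ∀ v w L → All (λ j → G w j ≡ G v j) L → nullityOn G (w ∷ L) ≡ nullityOn G (v ∷ L)
  nullityOn-twin v w L w≈v = nullityOn-cong G (w ∷ L) G (v ∷ L)
    (cubeSum-cong (length L) (λ z _ → Σ𝔹-cong (λ a → cong ⟦_⟧ (swap z a))))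
    where
    swap : ∀ z a → inKernelOn G (w ∷ L) (a ∷ z) ≡ inKernelOn G (v ∷ L) (a ∷ z)
    swap z a rewrite loopless w | loopless v | dot-map-cong z w≈v = cong (not (ρ v L z) ∧_)
      (all-cong-local (All.map (cong (λ t → not ((t ∧ a) xor ρ _ L z))) (column L w≈v)))

  nullityOn-falseTwin : ∀ v w L → G v w ≡ false → All (λ j → G w j ≡ G v j) L →
    nullityOn G (v ∷ w ∷ L) ≡ suc (nullityOn G (v ∷ L))
  nullityOn-falseTwin v w L v↛w w≈v = nullityOn-suc G (v ∷ w ∷ L) G (v ∷ L) (trans
    (cubeSum-cong (length L) (λ z _ → fibre z))
    (cubeSum-* (length L) 2 (λ z → Σ𝔹 (λ a → ⟦ inKernelOn G (v ∷ L) (a ∷ z) ⟧))))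
    where
    K : ∀ z a b → inKernelOn G (v ∷ w ∷ L) (a ∷ b ∷ z) ≡ inKernelOn G (v ∷ L) ((a xor b) ∷ z)
    K z a b rewrite loopless v | loopless w | symmetric w v | v↛w | dot-map-cong z w≈v = begin
      not (ρ v L z) ∧ (not (ρ v L z) ∧ all row L)  ≡⟨ ∧-assoc (not (ρ v L z)) (not (ρ v L z)) (all row L) ⟨
      (not (ρ v L z) ∧ not (ρ v L z)) ∧ all row L  ≡⟨ cong₂ _∧_ (∧-idem (not (ρ v L z)))
                                                              (all-cong-local (All.map factor (column L w≈v))) ⟩
      not (ρ v L z) ∧ all row′ L                    ∎
      where
      open ≡-Reasoning
      row row′ : Fin n → Bool
      row i = not ((G i v ∧ a) xor ((G i w ∧ b) xor ρ i L z))
      row′ i = not ((G i v ∧ (a xor b)) xor ρ i L z)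
      factor : ∀ {i} → G i w ≡ G i v → row i ≡ row′ i
      factor {i} i→w≈i→v = cong not (trans (cong (λ t → (G i v ∧ a) xor ((t ∧ b) xor ρ i L z)) i→w≈i→v)
                                            (∧-xor-factor (G i v) a b (ρ i L z)))
    fibre : ∀ z → Σ𝔹 (λ b → Σ𝔹 (λ a → ⟦ inKernelOn G (v ∷ w ∷ L) (a ∷ b ∷ z) ⟧))
                ≡ 2 ℕ.* Σ𝔹 (λ a → ⟦ inKernelOn G (v ∷ L) (a ∷ z) ⟧)
    fibre z = trans
      (Σ𝔹-cong (λ b → trans (Σ𝔹-cong (λ a → cong ⟦_⟧ (K z a b)))
                             (Σ𝔹-shift b (λ c → ⟦ inKernelOn G (v ∷ L) (c ∷ z) ⟧))))
      (Σ𝔹-const (Σ𝔹 (λ a → ⟦ inKernelOn G (v ∷ L) (a ∷ z) ⟧)))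

  nullityOn-trueTwin : ∀ v w L → G v w ≡ true → All (λ j → G w j ≡ G v j) L →
    nullityOn G (v ∷ w ∷ L) ≡ nullityOn G L
  nullityOn-trueTwin v w L v→w w≈v = nullityOn-cong G (v ∷ w ∷ L) G L (cubeSum-cong (length L) fibre)
    where
    T : List Bool → Bool → Bool → Bool
    T z a b = all (λ i → not ((G i v ∧ a) xor ((G i v ∧ b) xor ρ i L z))) L
    K : ∀ z a b →
      inKernelOn G (v ∷ w ∷ L) (a ∷ b ∷ z) ≡ not (b xor ρ v L z) ∧ (not (a xor ρ v L z) ∧ T z a b)
    K z a b rewrite loopless v | loopless w | symmetric w v | v→w | dot-map-cong z w≈v =
      cong (λ t → not (b xor ρ v L z) ∧ (not (a xor ρ v L z) ∧ t)) (all-cong-local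
        (All.map (cong (λ t → not ((G _ v ∧ a) xor ((t ∧ b) xor ρ _ L z)))) (column L w≈v)))
    fibre : ∀ z → length z ≡ length L →
      Σ𝔹 (λ b → Σ𝔹 (λ a → ⟦ inKernelOn G (v ∷ w ∷ L) (a ∷ b ∷ z) ⟧)) ≡ ⟦ inKernelOn G L z ⟧
    fibre z _ = begin
      Σ𝔹 (λ b → Σ𝔹 (λ a → ⟦ inKernelOn G (v ∷ w ∷ L) (a ∷ b ∷ z) ⟧))
        ≡⟨ Σ𝔹-cong (λ b → trans (Σ𝔹-cong (λ a → cong ⟦_⟧ (K z a b)))
                                (Σ𝔹-solve (not (b xor ρ v L z)) (ρ v L z) (λ a → T z a b))) ⟩
      Σ𝔹 (λ b → ⟦ not (b xor ρ v L z) ∧ T z (ρ v L z) b ⟧)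
        ≡⟨ Σ𝔹-solve true (ρ v L z) (T z (ρ v L z)) ⟩
      ⟦ T z (ρ v L z) (ρ v L z) ⟧
        ≡⟨ cong ⟦_⟧ (cong and (List.map-cong (λ i → cong not (xor-cancelˡ (G i v ∧ ρ v L z) (ρ i L z))) L)) ⟩
      ⟦ inKernelOn G L z ⟧ ∎
      where open ≡-Reasoning

  nullityOn-pivot-keep : ∀ u v L → All (_≢ u) L → All (_≢ v) L →
    nullityOn (pivot G u v) (v ∷ L) ≡ nullityOn G (v ∷ L)
  nullityOn-pivot-keep u v L L∌u L∌v = nullityOn-cong (pivot G u v) (v ∷ L) G (v ∷ L)
    (cubeSum-cong (length L) (λ z _ → trans (Σ𝔹-cong (λ a → cong ⟦_⟧ (K z a)))
      (Σ𝔹-shift (ρ u L z) (λ a → ⟦ inKernelOn G (v ∷ L) (a ∷ z) ⟧))))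
    where
    P : Graph n
    P = pivot G u v
    row : ∀ z a {i} → i ≢ u × i ≢ v → ρ v L z ≡ false →
      not ((P i v ∧ a) xor dot (map (P i) L) z) ≡ not ((G i v ∧ (a xor ρ u L z)) xor ρ i L z)
    row z a {i} (i≢u , i≢v) ρv≡0 = cong not (begin
      (P i v ∧ a) xor dot (map (P i) L) z
        ≡⟨ cong₂ (λ s t → (s ∧ a) xor t) (pivot-col-v G u v i) (dot-pivot G u v L z i≢u i≢v L∌u L∌v) ⟩
      (G i v ∧ a) xor (ρ i L z xor ((G u i ∧ ρ v L z) xor (G v i ∧ ρ u L z)))
        ≡⟨ cong (λ t → (G i v ∧ a) xor (ρ i L z xor ((G u i ∧ t) xor (G v i ∧ ρ u L z)))) ρv≡0 ⟩
      (G i v ∧ a) xor (ρ i L z xor ((G u i ∧ false) xor (G v i ∧ ρ u L z)))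
        ≡⟨ cong (λ t → (G i v ∧ a) xor (ρ i L z xor (t xor (G v i ∧ ρ u L z)))) (∧-zeroʳ (G u i)) ⟩
      (G i v ∧ a) xor (ρ i L z xor (G v i ∧ ρ u L z))
        ≡⟨ cong (λ t → (G i v ∧ a) xor t) (xor-comm (ρ i L z) (G v i ∧ ρ u L z)) ⟩
      (G i v ∧ a) xor ((G v i ∧ ρ u L z) xor ρ i L z)
        ≡⟨ cong (λ t → (G i v ∧ a) xor ((t ∧ ρ u L z) xor ρ i L z)) (symmetric v i) ⟩
      (G i v ∧ a) xor ((G i v ∧ ρ u L z) xor ρ i L z)
        ≡⟨ ∧-xor-factor (G i v) a (ρ u L z) (ρ i L z) ⟩
      (G i v ∧ (a xor ρ u L z)) xor ρ i L z ∎)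
      where open ≡-Reasoning
    K : ∀ z a → inKernelOn P (v ∷ L) (a ∷ z) ≡ inKernelOn G (v ∷ L) ((a xor ρ u L z) ∷ z)
    K z a rewrite pivot-row-v G u v v | loopless v | List.map-cong (pivot-row-v G u v) L =
      not∧-cong (ρ v L z) (λ ρv≡0 → all-cong-local (All.map (λ out → row z a out ρv≡0) (All.zip (L∌u , L∌v))))

  nullityOn-pivot-drop : ∀ u v L → G u v ≡ true → All (_≢ u) L → All (_≢ v) L →
    nullityOn G (u ∷ v ∷ L) ≡ nullityOn (pivot G u v) L
  nullityOn-pivot-drop u v L u→v L∌u L∌v =
    nullityOn-cong G (u ∷ v ∷ L) (pivot G u v) L (cubeSum-cong (length L) fibre)
    where
    T : List Bool → Bool → Bool → Bool
    T z a b = all (λ i → not ((G i u ∧ a) xor ((G i v ∧ b) xor ρ i L z))) L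
    K : ∀ z a b →
      inKernelOn G (u ∷ v ∷ L) (a ∷ b ∷ z) ≡ not (b xor ρ u L z) ∧ (not (a xor ρ v L z) ∧ T z a b)
    K z a b rewrite loopless u | loopless v | symmetric v u | u→v = refl
    row : ∀ z {i} → i ≢ u × i ≢ v →
      not ((G i u ∧ ρ v L z) xor ((G i v ∧ ρ u L z) xor ρ i L z)) ≡ not (dot (map (pivot G u v i) L) z)
    row z {i} (i≢u , i≢v) = cong not (begin
      (G i u ∧ ρ v L z) xor ((G i v ∧ ρ u L z) xor ρ i L z)
        ≡⟨ cong₂ (λ s t → (s ∧ ρ v L z) xor ((t ∧ ρ u L z) xor ρ i L z)) (symmetric i u) (symmetric i v) ⟩
      (G u i ∧ ρ v L z) xor ((G v i ∧ ρ u L z) xor ρ i L z)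
        ≡⟨ Xor.x∙yz≈z∙xy (G u i ∧ ρ v L z) (G v i ∧ ρ u L z) (ρ i L z) ⟩
      ρ i L z xor ((G u i ∧ ρ v L z) xor (G v i ∧ ρ u L z))
        ≡⟨ dot-pivot G u v L z i≢u i≢v L∌u L∌v ⟨
      dot (map (pivot G u v i) L) z ∎)
      where open ≡-Reasoning
    fibre : ∀ z → length z ≡ length L →
      Σ𝔹 (λ b → Σ𝔹 (λ a → ⟦ inKernelOn G (u ∷ v ∷ L) (a ∷ b ∷ z) ⟧)) ≡ ⟦ inKernelOn (pivot G u v) L z ⟧
    fibre z _ = begin
      Σ𝔹 (λ b → Σ𝔹 (λ a → ⟦ inKernelOn G (u ∷ v ∷ L) (a ∷ b ∷ z) ⟧))
        ≡⟨ Σ𝔹-cong (λ b → trans (Σ𝔹-cong (λ a → cong ⟦_⟧ (K z a b)))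
                                (Σ𝔹-solve (not (b xor ρ u L z)) (ρ v L z) (λ a → T z a b))) ⟩
      Σ𝔹 (λ b → ⟦ not (b xor ρ u L z) ∧ T z (ρ v L z) b ⟧)
        ≡⟨ Σ𝔹-solve true (ρ u L z) (T z (ρ v L z)) ⟩
      ⟦ T z (ρ v L z) (ρ u L z) ⟧
        ≡⟨ cong ⟦_⟧ (all-cong-local (All.map (row z) (All.zip (L∌u , L∌v)))) ⟩
      ⟦ inKernelOn (pivot G u v) L z ⟧ ∎
      where open ≡-Reasoning

-- Subsets

keep-map : ∀ {A B : Set} (p : B → Bool) (f : A → B) xs → keep p (map f xs) ≡ map f (keep (p ∘ f) xs)
keep-map p f []       = refl
keep-map p f (x ∷ xs) with p (f x)
... | true  = cong (f x ∷_) (keep-map p f xs)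
... | false = keep-map p f xs

keep-true : ∀ {A : Set} (p : A → Bool) xs → All (λ x → p x ≡ true) (keep p xs)
keep-true p []       = []
keep-true p (x ∷ xs) with p x in px
... | true  = px ∷ keep-true p xs
... | false = keep-true p xs

members-false∷ : ∀ {n} (W : Vec Bool n) → members (false ∷ W) ≡ map suc (members W)
members-false∷ {n} W = keep-map (lookup (false ∷ W)) suc (allFin n)

members-true∷ : ∀ {n} (W : Vec Bool n) → members (true ∷ W) ≡ zero ∷ map suc (members W)
members-true∷ {n} W = cong (zero ∷_) (keep-map (lookup (true ∷ W)) suc (allFin n))

members-avoid : ∀ {n} (W : Vec Bool n) j → lookup W j ≡ false → All (_≢ j) (members W)
members-avoid {n} W j W[j] = All.map (λ W[i] i≡j → contradiction
  (trans (sym W[i]) (trans (cong (lookup W) i≡j) W[j])) λ ()) (keep-true (lookup W) (allFin n))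

map-suc-punchIn : ∀ {n} (j : Fin (suc n)) xs → map suc (map (punchIn j) xs) ≡ map (punchIn (suc j)) (map suc xs)
map-suc-punchIn j xs = trans (sym (List.map-∘ xs)) (List.map-∘ xs)

members-insertAt-false : ∀ {n} (W : Vec Bool n) j → members (insertAt W j false) ≡ map (punchIn j) (members W)
members-insertAt-false W           zero    = members-false∷ W
members-insertAt-false (false ∷ W) (suc j) = begin
  members (false ∷ insertAt W j false)          ≡⟨ members-false∷ (insertAt W j false) ⟩
  map suc (members (insertAt W j false))        ≡⟨ cong (map suc) (members-insertAt-false W j) ⟩
  map suc (map (punchIn j) (members W))         ≡⟨ map-suc-punchIn j (members W) ⟩
  map (punchIn (suc j)) (map suc (members W))   ≡⟨ cong (map (punchIn (suc j))) (members-false∷ W) ⟨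
  map (punchIn (suc j)) (members (false ∷ W))   ∎
  where open ≡-Reasoning
members-insertAt-false (true ∷ W)  (suc j) = begin
  members (true ∷ insertAt W j false)                  ≡⟨ members-true∷ (insertAt W j false) ⟩
  zero ∷ map suc (members (insertAt W j false))        ≡⟨ cong (λ L → zero ∷ map suc L) (members-insertAt-false W j) ⟩
  zero ∷ map suc (map (punchIn j) (members W))         ≡⟨ cong (zero ∷_) (map-suc-punchIn j (members W)) ⟩
  zero ∷ map (punchIn (suc j)) (map suc (members W))   ≡⟨ cong (map (punchIn (suc j))) (members-true∷ W) ⟨
  map (punchIn (suc j)) (members (true ∷ W))           ∎
  where open ≡-Reasoning

members-insertAt-true : ∀ {n} (W : Vec Bool n) j →
  ∃ λ p → members (insertAt W j true) ≡ insertAtℕ (members (insertAt W j false)) p j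
members-insertAt-true W zero = 0 , trans (members-true∷ W) (cong (zero ∷_) (sym (members-false∷ W)))
members-insertAt-true (b ∷ W) (suc j) with members-insertAt-true W j
members-insertAt-true (false ∷ W) (suc j) | p , eq = p , (begin
  members (false ∷ insertAt W j true)                     ≡⟨ members-false∷ (insertAt W j true) ⟩
  map suc (members (insertAt W j true))                   ≡⟨ cong (map suc) eq ⟩
  map suc (insertAtℕ (members (insertAt W j false)) p j)  ≡⟨ map-insertAtℕ suc (members (insertAt W j false)) p j ⟩
  insertAtℕ (map suc (members (insertAt W j false))) p (suc j)
    ≡⟨ cong (λ L → insertAtℕ L p (suc j)) (members-false∷ (insertAt W j false)) ⟨
  insertAtℕ (members (false ∷ insertAt W j false)) p (suc j) ∎)
  where open ≡-Reasoning
members-insertAt-true (true ∷ W) (suc j) | p , eq = suc p , (begin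
  members (true ∷ insertAt W j true)                             ≡⟨ members-true∷ (insertAt W j true) ⟩
  zero ∷ map suc (members (insertAt W j true))                   ≡⟨ cong (λ L → zero ∷ map suc L) eq ⟩
  zero ∷ map suc (insertAtℕ (members (insertAt W j false)) p j)
    ≡⟨ cong (zero ∷_) (map-insertAtℕ suc (members (insertAt W j false)) p j) ⟩
  insertAtℕ (zero ∷ map suc (members (insertAt W j false))) (suc p) (suc j)
    ≡⟨ cong (λ L → insertAtℕ L (suc p) (suc j)) (members-true∷ (insertAt W j false)) ⟨
  insertAtℕ (members (true ∷ insertAt W j false)) (suc p) (suc j) ∎)
  where open ≡-Reasoning

insertAt-comm : ∀ {A : Set} {m} (R : Vec A m) {u v : Fin (suc (suc m))} (v≢u : v ≢ u) (u≢v : u ≢ v) a b →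
  insertAt (insertAt R (punchOut v≢u) a) v b ≡ insertAt (insertAt R (punchOut u≢v) b) u a
insertAt-comm R {zero} {zero} v≢u _ a b = contradiction refl v≢u
insertAt-comm R {zero} {suc v} _ _ a b = refl
insertAt-comm R {suc u} {zero} _ _ a b = refl
insertAt-comm {m = zero} [] {suc zero} {suc zero} v≢u _ a b = contradiction refl v≢u
insertAt-comm {m = suc m} (r ∷ R) {suc u} {suc v} v≢u u≢v a b =
  cong (r ∷_) (insertAt-comm R (v≢u ∘ cong suc) (u≢v ∘ cong suc) a b)

nullity-insertAt-true : ∀ {n} (G : Graph (suc n)) W j →
  nullity G (insertAt W j true) ≡ nullityOn G (j ∷ members (insertAt W j false))
nullity-insertAt-true G W j with members-insertAt-true W j
... | p , eq = trans (cong (nullityOn G) eq) (nullityOn-insertAtℕ G (members (insertAt W j false)) p j)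

nullity-deleteV : ∀ {n} (G : Graph (suc n)) u W → nullity (deleteV G u) W ≡ nullity G (insertAt W u false)
nullity-deleteV G u W = trans (nullityOn-map G (punchIn u) (members W))
  (cong (nullityOn G) (sym (members-insertAt-false W u)))

nullity-true∷ : ∀ {n} (G : Graph (suc n)) W → nullity G (true ∷ W) ≡ nullityOn G (zero ∷ map suc (members W))
nullity-true∷ G W = cong (nullityOn G) (members-true∷ W)

nullity-true∷-insertAt-true : ∀ {n} (G : Graph (suc (suc n))) W j →
  nullity G (true ∷ insertAt W j true) ≡ nullityOn G (suc j ∷ zero ∷ map suc (members (insertAt W j false)))
nullity-true∷-insertAt-true G W j = trans (nullity-insertAt-true G (true ∷ W) (suc j))
  (cong (λ L → nullityOn G (suc j ∷ L)) (members-true∷ (insertAt W j false)))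

-- Adding a vertex

addVertex-isSimple : ∀ {n} {G : Graph n} → IsSimple G → ∀ nb → IsSimple (addVertex G nb)
addVertex-isSimple {G = G} simple nb = record { sym = symmetric ; irrefl = loopless }
  where
  symmetric : ∀ i j → addVertex G nb i j ≡ addVertex G nb j i
  symmetric zero    zero    = refl
  symmetric zero    (suc j) = refl
  symmetric (suc i) zero    = refl
  symmetric (suc i) (suc j) = IsSimple.sym simple i j
  loopless : ∀ i → addVertex G nb i i ≡ false
  loopless zero    = refl
  loopless (suc i) = IsSimple.irrefl simple i

nullity-addVertex-false∷ : ∀ {n} (G : Graph n) nb W → nullity (addVertex G nb) (false ∷ W) ≡ nullity G W
nullity-addVertex-false∷ G nb W = trans (cong (nullityOn (addVertex G nb)) (members-false∷ W))
  (sym (nullityOn-map (addVertex G nb) suc (members W)))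

trueTwin-agrees : ∀ {n} (G : Graph n) v {j} → j ≢ v → G v j ∨ (j == v) ≡ G v j
trueTwin-agrees G v {j} j≢v = trans (cong (G v j ∨_) (dec-false (j ≟ v) j≢v)) (∨-identityʳ (G v j))

module _ {n} (G : Graph (suc n)) (simple : IsSimple G) (W : Vec Bool n) where

  private
    simple′ : ∀ nb → IsSimple (addVertex G nb)
    simple′ = addVertex-isSimple simple
    L : Fin (suc n) → List (Fin (suc n))
    L j = members (insertAt W j false)
    L∌ : ∀ j → All (_≢ j) (L j)
    L∌ j = members-avoid (insertAt W j false) j (Vec.insertAt-lookup W j false)

  nullity-addPendant-absent : ∀ u →
    nullity (addPendant G u) (true ∷ insertAt W u false) ≡ suc (nullity (deleteV G u) W)
  nullity-addPendant-absent u = begin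
    nullity G′ (true ∷ insertAt W u false)    ≡⟨ nullity-true∷ G′ (insertAt W u false) ⟩
    nullityOn G′ (zero ∷ map suc (L u))      ≡⟨ nullityOn-isolated G′ (simple′ (_== u)) zero (map suc (L u))
                                                  (All.map⁺ (All.map (dec-false (_ ≟ u)) (L∌ u))) ⟩
    suc (nullityOn G′ (map suc (L u)))       ≡⟨ cong suc (nullityOn-map G′ suc (L u)) ⟨
    suc (nullityOn G (L u))                  ≡⟨ cong suc (nullity-deleteV G u W) ⟨
    suc (nullity (deleteV G u) W)            ∎
    where
    open ≡-Reasoning
    G′ : Graph (suc (suc n))
    G′ = addPendant G u

  nullity-addPendant-present : ∀ u → nullity (addPendant G u) (true ∷ insertAt W u true) ≡ nullity (deleteV G u) W
  nullity-addPendant-present u = begin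
    nullity G′ (true ∷ insertAt W u true)      ≡⟨ nullity-true∷-insertAt-true G′ W u ⟩
    nullityOn G′ (suc u ∷ zero ∷ map suc (L u)) ≡⟨ nullityOn-pendant G′ (simple′ (_== u)) (suc u) zero (map suc (L u))
                                                    (dec-true (u ≟ u) refl)
                                                    (All.map⁺ (All.map (dec-false (_ ≟ u)) (L∌ u))) ⟩
    nullityOn G′ (map suc (L u))               ≡⟨ nullityOn-map G′ suc (L u) ⟨
    nullityOn G (L u)                          ≡⟨ nullity-deleteV G u W ⟨
    nullity (deleteV G u) W                    ∎
    where
    open ≡-Reasoning
    G′ : Graph (suc (suc n))
    G′ = addPendant G u

  nullity-addTwin-absent : ∀ v nb → (∀ {j} → j ≢ v → nb j ≡ G v j) →
    nullity (addVertex G nb) (true ∷ insertAt W v false) ≡ nullity G (insertAt W v true)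
  nullity-addTwin-absent v nb agrees = begin
    nullity G′ (true ∷ insertAt W v false)   ≡⟨ nullity-true∷ G′ (insertAt W v false) ⟩
    nullityOn G′ (zero ∷ map suc (L v))     ≡⟨ nullityOn-twin G′ (simple′ nb) (suc v) zero (map suc (L v))
                                                 (All.map⁺ (All.map agrees (L∌ v))) ⟩
    nullityOn G′ (map suc (v ∷ L v))        ≡⟨ nullityOn-map G′ suc (v ∷ L v) ⟨
    nullityOn G (v ∷ L v)                   ≡⟨ nullity-insertAt-true G W v ⟨
    nullity G (insertAt W v true)           ∎
    where
    open ≡-Reasoning
    G′ : Graph (suc (suc n))
    G′ = addVertex G nb

  nullity-addFalseTwin-present : ∀ v →
    nullity (addFalseTwin G v) (true ∷ insertAt W v true) ≡ suc (nullity G (insertAt W v true))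
  nullity-addFalseTwin-present v = begin
    nullity G′ (true ∷ insertAt W v true)         ≡⟨ nullity-true∷-insertAt-true G′ W v ⟩
    nullityOn G′ (suc v ∷ zero ∷ map suc (L v))  ≡⟨ nullityOn-falseTwin G′ (simple′ (G v)) (suc v) zero (map suc (L v))
                                                      (IsSimple.irrefl simple v)
                                                      (All.map⁺ (All.universal (λ _ → refl) (L v))) ⟩
    suc (nullityOn G′ (map suc (v ∷ L v)))       ≡⟨ cong suc (nullityOn-map G′ suc (v ∷ L v)) ⟨
    suc (nullityOn G (v ∷ L v))                  ≡⟨ cong suc (nullity-insertAt-true G W v) ⟨
    suc (nullity G (insertAt W v true))          ∎
    where
    open ≡-Reasoning
    G′ : Graph (suc (suc n))
    G′ = addFalseTwin G v

  nullity-addTrueTwin-present : ∀ v →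
    nullity (addTrueTwin G v) (true ∷ insertAt W v true) ≡ nullity G (insertAt W v false)
  nullity-addTrueTwin-present v = begin
    nullity G′ (true ∷ insertAt W v true)         ≡⟨ nullity-true∷-insertAt-true G′ W v ⟩
    nullityOn G′ (suc v ∷ zero ∷ map suc (L v))  ≡⟨ nullityOn-trueTwin G′ (simple′ _) (suc v) zero (map suc (L v))
                                                      v→w (All.map⁺ (All.map (trueTwin-agrees G v) (L∌ v))) ⟩
    nullityOn G′ (map suc (L v))                 ≡⟨ nullityOn-map G′ suc (L v) ⟨
    nullity G (insertAt W v false)               ∎
    where
    open ≡-Reasoning
    G′ : Graph (suc (suc n))
    G′ = addTrueTwin G v
    v→w : G v v ∨ (v == v) ≡ true
    v→w = trans (cong (G v v ∨_) (dec-true (v ≟ v) refl)) (∨-zeroʳ (G v v))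

-- The polynomial q_N

sumOver : ∀ {A : Set} → List A → (A → ℤ) → ℤ
sumOver xs F = foldr _+_ (+ 0) (map F xs)

sumOver-cong : ∀ {A : Set} xs {F F′ : A → ℤ} → (∀ x → F x ≡ F′ x) → sumOver xs F ≡ sumOver xs F′
sumOver-cong xs F≡F′ = cong (foldr _+_ (+ 0)) (List.map-cong F≡F′ xs)

sumOver-+ : ∀ {A : Set} xs (F F′ : A → ℤ) → sumOver xs (λ x → F x + F′ x) ≡ sumOver xs F + sumOver xs F′
sumOver-+ []       F F′ = refl
sumOver-+ (x ∷ xs) F F′ = trans (cong (_+_ (F x + F′ x)) (sumOver-+ xs F F′))
  (ℤ+.interchange (F x) (F′ x) (sumOver xs F) (sumOver xs F′))

sumOver-* : ∀ {A : Set} xs c (F : A → ℤ) → sumOver xs (λ x → c * F x) ≡ c * sumOver xs F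
sumOver-* []       c F = sym (ℤ.*-zeroʳ c)
sumOver-* (x ∷ xs) c F =
  trans (cong (_+_ (c * F x)) (sumOver-* xs c F)) (sym (ℤ.*-distribˡ-+ c (F x) (sumOver xs F)))

sumOver-++ : ∀ {A : Set} xs ys (F : A → ℤ) → sumOver (xs ++ ys) F ≡ sumOver xs F + sumOver ys F
sumOver-++ []       ys F = sym (ℤ.+-identityˡ (sumOver ys F))
sumOver-++ (x ∷ xs) ys F =
  trans (cong (_+_ (F x)) (sumOver-++ xs ys F)) (sym (ℤ.+-assoc (F x) (sumOver xs F) (sumOver ys F)))

sumOver-map : ∀ {A B : Set} (g : A → B) xs (F : B → ℤ) → sumOver (map g xs) F ≡ sumOver xs (F ∘ g)
sumOver-map g xs F = cong (foldr _+_ (+ 0)) (sym (List.map-∘ xs))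

Σ⊆ : ∀ n → (Vec Bool n → ℤ) → ℤ
Σ⊆ n F = sumOver (subsets n) F

Σ⊆-cong : ∀ n {F F′ : Vec Bool n → ℤ} → (∀ W → F W ≡ F′ W) → Σ⊆ n F ≡ Σ⊆ n F′
Σ⊆-cong n = sumOver-cong (subsets n)

Σ⊆-suc : ∀ n (F : Vec Bool (suc n) → ℤ) → Σ⊆ (suc n) F ≡ Σ⊆ n (λ W → F (false ∷ W)) + Σ⊆ n (λ W → F (true ∷ W))
Σ⊆-suc n F = trans (sumOver-++ (map (false ∷_) (subsets n)) (map (true ∷_) (subsets n)) F)
  (cong₂ _+_ (sumOver-map (false ∷_) (subsets n) F) (sumOver-map (true ∷_) (subsets n) F))

Σ⊆-insertAt : ∀ n j (F : Vec Bool (suc n) → ℤ) →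
  Σ⊆ (suc n) F ≡ Σ⊆ n (λ W → F (insertAt W j false) + F (insertAt W j true))
Σ⊆-insertAt n       zero    F =
  trans (Σ⊆-suc n F) (sym (sumOver-+ (subsets n) (λ W → F (false ∷ W)) (λ W → F (true ∷ W))))
Σ⊆-insertAt (suc n) (suc j) F = begin
  Σ⊆ (suc (suc n)) F
    ≡⟨ Σ⊆-suc (suc n) F ⟩
  Σ⊆ (suc n) (λ W → F (false ∷ W)) + Σ⊆ (suc n) (λ W → F (true ∷ W))
    ≡⟨ cong₂ _+_ (Σ⊆-insertAt n j (λ W → F (false ∷ W))) (Σ⊆-insertAt n j (λ W → F (true ∷ W))) ⟩
  Σ⊆ n (λ W → F (false ∷ insertAt W j false) + F (false ∷ insertAt W j true))
    + Σ⊆ n (λ W → F (true ∷ insertAt W j false) + F (true ∷ insertAt W j true))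
    ≡⟨ Σ⊆-suc n (λ W → F (insertAt W (suc j) false) + F (insertAt W (suc j) true)) ⟨
  Σ⊆ (suc n) (λ W → F (insertAt W (suc j) false) + F (insertAt W (suc j) true)) ∎
  where open ≡-Reasoning

y+[x-1]*y≡x*y : ∀ x y → y + (x - + 1) * y ≡ x * y
y+[x-1]*y≡x*y = solve-∀

qN-addVertex : ∀ {n} (G : Graph (suc n)) nb j x →
  qN (addVertex G nb) x ≡ qN G x + Σ⊆ n (λ W → (x - + 1) ^ nullity (addVertex G nb) (true ∷ insertAt W j false)
                                              + (x - + 1) ^ nullity (addVertex G nb) (true ∷ insertAt W j true))
qN-addVertex {n} G nb j x = trans (Σ⊆-suc (suc n) (λ W → (x - + 1) ^ nullity (addVertex G nb) W))
  (cong₂ _+_ (Σ⊆-cong (suc n) (λ W → cong ((x - + 1) ^_) (nullity-addVertex-false∷ G nb W)))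
             (Σ⊆-insertAt n j (λ W → (x - + 1) ^ nullity (addVertex G nb) (true ∷ W))))

module _ {m} (G : Graph (suc (suc m))) (simple : IsSimple G) (u v : Fin (suc (suc m))) (u→v : G u v ≡ true) where

  private
    P : Graph (suc (suc m))
    P = pivot G u v
    u≢v : u ≢ v
    u≢v u≡v = contradiction (trans (sym u→v) (trans (cong (G u) (sym u≡v)) (IsSimple.irrefl simple u))) λ ()
    u₁ v₁ : Fin (suc m)
    u₁ = punchOut (u≢v ∘ sym)
    v₁ = punchOut u≢v
    Yᵥ Yᵤ : Bool → Bool → Vec Bool m → Vec Bool (suc (suc m))
    Yᵥ a b R = insertAt (insertAt R u₁ a) v b
    Yᵤ a b R = insertAt (insertAt R v₁ b) u a
    Yᵥ≡Yᵤ : ∀ a b R → Yᵥ a b R ≡ Yᵤ a b R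
    Yᵥ≡Yᵤ a b R = insertAt-comm R (u≢v ∘ sym) u≢v a b
    L₀ : Vec Bool m → List (Fin (suc (suc m)))
    L₀ R = members (Yᵤ false false R)
    L₀∌u : ∀ R → All (_≢ u) (L₀ R)
    L₀∌u R = members-avoid (Yᵤ false false R) u (Vec.insertAt-lookup (insertAt R v₁ false) u false)
    L₀∌v : ∀ R → All (_≢ v) (L₀ R)
    L₀∌v R = members-avoid (Yᵤ false false R) v
      (trans (cong (λ Y → lookup Y v) (sym (Yᵥ≡Yᵤ false false R)))
             (Vec.insertAt-lookup (insertAt R u₁ false) v false))

  nullity-pivot-withoutU : ∀ R → nullity G (Yᵥ false true R) ≡ nullity P (Yᵤ false true R)
  nullity-pivot-withoutU R = begin
    nullity G (Yᵥ false true R)                    ≡⟨ nullity-insertAt-true G (insertAt R u₁ false) v ⟩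
    nullityOn G (v ∷ members (Yᵥ false false R))   ≡⟨ cong (λ Y → nullityOn G (v ∷ members Y)) (Yᵥ≡Yᵤ false false R) ⟩
    nullityOn G (v ∷ L₀ R)                         ≡⟨ nullityOn-pivot-keep G simple u v (L₀ R) (L₀∌u R) (L₀∌v R) ⟨
    nullityOn P (v ∷ L₀ R)                         ≡⟨ cong (λ Y → nullityOn P (v ∷ members Y)) (Yᵥ≡Yᵤ false false R) ⟨
    nullityOn P (v ∷ members (Yᵥ false false R))   ≡⟨ nullity-insertAt-true P (insertAt R u₁ false) v ⟨
    nullity P (Yᵥ false true R)                    ≡⟨ cong (nullity P) (Yᵥ≡Yᵤ false true R) ⟩
    nullity P (Yᵤ false true R)                    ∎
    where open ≡-Reasoning

  nullity-pivot-withU : ∀ R → nullity G (Yᵥ true true R) ≡ nullity P (Yᵤ false false R)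
  nullity-pivot-withU R with members-insertAt-true (insertAt R v₁ false) u
  ... | q , eq = begin
    nullity G (Yᵥ true true R)                    ≡⟨ nullity-insertAt-true G (insertAt R u₁ true) v ⟩
    nullityOn G (v ∷ members (Yᵥ true false R))   ≡⟨ cong (λ Y → nullityOn G (v ∷ members Y)) (Yᵥ≡Yᵤ true false R) ⟩
    nullityOn G (v ∷ members (Yᵤ true false R))   ≡⟨ cong (λ L → nullityOn G (v ∷ L)) eq ⟩
    nullityOn G (v ∷ insertAtℕ (L₀ R) q u)        ≡⟨ nullityOn-insertAtℕ G (v ∷ L₀ R) (suc q) u ⟩
    nullityOn G (u ∷ v ∷ L₀ R)                    ≡⟨ nullityOn-pivot-drop G simple u v (L₀ R) u→v (L₀∌u R) (L₀∌v R) ⟩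
    nullityOn P (L₀ R)                            ∎
    where open ≡-Reasoning

  -- Subsets of G^{uv} - u are matched with subsets of G containing v: those containing v with
  -- themselves, the others with their union with {u, v}.
  qN-deleteV-pivot-suc : ∀ x → qN (deleteV P u) x ≡ Σ⊆ (suc m) (λ W → (x - + 1) ^ nullity G (insertAt W v true))
  qN-deleteV-pivot-suc x = begin
    qN (deleteV P u) x
      ≡⟨ Σ⊆-cong (suc m) (λ W → cong E (nullity-deleteV P u W)) ⟩
    Σ⊆ (suc m) (λ W → E (nullity P (insertAt W u false)))
      ≡⟨ Σ⊆-insertAt m v₁ (λ W → E (nullity P (insertAt W u false))) ⟩
    Σ⊆ m (λ R → E (nullity P (Yᵤ false false R)) + E (nullity P (Yᵤ false true R)))
      ≡⟨ Σ⊆-cong m (λ R → trans (ℤ.+-comm (E (nullity P (Yᵤ false false R))) (E (nullity P (Yᵤ false true R))))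
           (cong₂ _+_ (cong E (sym (nullity-pivot-withoutU R))) (cong E (sym (nullity-pivot-withU R))))) ⟩
    Σ⊆ m (λ R → E (nullity G (Yᵥ false true R)) + E (nullity G (Yᵥ true true R)))
      ≡⟨ Σ⊆-insertAt m u₁ (λ W → E (nullity G (insertAt W v true))) ⟨
    Σ⊆ (suc m) (λ W → E (nullity G (insertAt W v true))) ∎
    where
    open ≡-Reasoning
    E : ℕ → ℤ
    E k = (x - + 1) ^ k

qN-deleteV-pivot : ∀ {n} (G : Graph (suc n)) → IsSimple G → ∀ u v → G u v ≡ true → ∀ x →
  qN (deleteV (pivot G u v) u) x ≡ Σ⊆ n (λ W → (x - + 1) ^ nullity G (insertAt W v true))
qN-deleteV-pivot {zero}  G simple zero     zero     u→v x =
  contradiction (trans (sym u→v) (IsSimple.irrefl simple zero)) λ ()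
qN-deleteV-pivot {zero}  G simple zero     (suc ()) u→v x
qN-deleteV-pivot {zero}  G simple (suc ()) v        u→v x
qN-deleteV-pivot {suc m} G simple u        v        u→v x = qN-deleteV-pivot-suc G simple u v u→v x

module _ {n} (G : Graph (suc n)) (simple : IsSimple G) (x : ℤ) where

  private
    E : ℕ → ℤ
    E k = (x - + 1) ^ k

  qN-addPendant : ∀ u → qN (addPendant G u) x ≡ qN G x + x * qN (deleteV G u) x
  qN-addPendant u = trans (qN-addVertex G (_== u) u x) (cong (_+_ (qN G x)) (begin
    Σ⊆ n (λ W → E (nullity G′ (true ∷ insertAt W u false)) + E (nullity G′ (true ∷ insertAt W u true)))
      ≡⟨ Σ⊆-cong n (λ W → cong₂ _+_ (cong E (nullity-addPendant-absent G simple W u))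
                                    (cong E (nullity-addPendant-present G simple W u))) ⟩
    Σ⊆ n (λ W → E (suc (d W)) + E (d W))
      ≡⟨ Σ⊆-cong n (λ W → trans (ℤ.+-comm (E (suc (d W))) (E (d W))) (y+[x-1]*y≡x*y x (E (d W)))) ⟩
    Σ⊆ n (λ W → x * E (d W))
      ≡⟨ sumOver-* (subsets n) x (λ W → E (d W)) ⟩
    x * qN (deleteV G u) x ∎))
    where
    open ≡-Reasoning
    G′ : Graph (suc (suc n))
    G′ = addPendant G u
    d : Vec Bool n → ℕ
    d W = nullity (deleteV G u) W

  qN-addFalseTwin : ∀ v u → G u v ≡ true → qN (addFalseTwin G v) x ≡ qN G x + x * qN (deleteV (pivot G u v) u) x
  qN-addFalseTwin v u u→v = trans (qN-addVertex G (G v) v x) (cong (_+_ (qN G x)) (begin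
    Σ⊆ n (λ W → E (nullity G′ (true ∷ insertAt W v false)) + E (nullity G′ (true ∷ insertAt W v true)))
      ≡⟨ Σ⊆-cong n (λ W → trans
           (cong₂ _+_ (cong E (nullity-addTwin-absent G simple W v (G v) (λ _ → refl)))
                      (cong E (nullity-addFalseTwin-present G simple W v)))
           (y+[x-1]*y≡x*y x (E (e W)))) ⟩
    Σ⊆ n (λ W → x * E (e W))
      ≡⟨ sumOver-* (subsets n) x (λ W → E (e W)) ⟩
    x * Σ⊆ n (λ W → E (e W))
      ≡⟨ cong (x *_) (qN-deleteV-pivot G simple u v u→v x) ⟨
    x * qN (deleteV (pivot G u v) u) x ∎))
    where
    open ≡-Reasoning
    G′ : Graph (suc (suc n))
    G′ = addFalseTwin G v
    e : Vec Bool n → ℕ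
    e W = nullity G (insertAt W v true)

  qN-addTrueTwin : ∀ v → qN (addTrueTwin G v) x ≡ + 2 * qN G x
  qN-addTrueTwin v = trans (qN-addVertex G (λ j → G v j ∨ (j == v)) v x) (begin
    qN G x + Σ⊆ n (λ W → E (nullity G′ (true ∷ insertAt W v false)) + E (nullity G′ (true ∷ insertAt W v true)))
      ≡⟨ cong (_+_ (qN G x)) (Σ⊆-cong n (λ W → trans
           (cong₂ _+_ (cong E (nullity-addTwin-absent G simple W v _ (trueTwin-agrees G v)))
                      (cong E (nullity-addTrueTwin-present G simple W v)))
           (ℤ.+-comm (E (nullity G (insertAt W v true))) (E (nullity G (insertAt W v false)))))) ⟩
    qN G x + Σ⊆ n (λ W → E (nullity G (insertAt W v false)) + E (nullity G (insertAt W v true)))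
      ≡⟨ cong (_+_ (qN G x)) (Σ⊆-insertAt n v (λ W → E (nullity G W))) ⟨
    qN G x + qN G x
      ≡⟨ y+y≡2*y (qN G x) ⟩
    + 2 * qN G x ∎)
    where
    open ≡-Reasoning
    G′ : Graph (suc (suc n))
    G′ = addTrueTwin G v
    y+y≡2*y : ∀ y → y + y ≡ + 2 * y
    y+y≡2*y = solve-∀

corollary4p14 : (n : ℕ) (G : Graph (suc n)) → IsSimple G →
    ((u : Fin (suc n)) (x : ℤ) →
       qN (addPendant G u) x ≡ qN G x + x * qN (deleteV G u) x)
    × ((v u : Fin (suc n)) → NonIsolated G v → G u v ≡ true → (x : ℤ) →
       qN (addFalseTwin G v) x ≡ qN G x + x * qN (deleteV (pivot G u v) u) x)
    × ((v : Fin (suc n)) → NonIsolated G v → (x : ℤ) →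
       qN (addTrueTwin G v) x ≡ + 2 * qN G x)
corollary4p14 n G simple =
    (λ u x → qN-addPendant G simple x u)
  , (λ v u _ u→v x → qN-addFalseTwin G simple x v u u→v)
  , (λ v _ x → qN-addTrueTwin G simple x v)
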